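{- Let $G$ be a two-rooted graph on vertices $v_1,\dots,v_n$ with roots $v_1,v_n$, let $M$ be its adjacency matrix over $\mathbb F_2$, and let $\mathrm{cent}_{r,c}(M)$ be the $(n-2)\times(n-2)$ matrix obtained from $M$ by deleting its first and last rows and columns. Then every sequence of \textbf{gcds} operations starting from $G$ and ending at a fixed point (a graph to which no \textbf{gcds} operation can be applied) has exactly $\tfrac12\operatorname{rank}(\mathrm{cent}_{r,c}(M))$ steps.
   Context: A two-rooted graph is a finite simple undirected graph with two designated roots. With $f_a(b)=1$ iff $a,b$ adjacent, for adjacent non-root vertices $p,q$, $\textbf{gcds}_{\{p,q\}}(G)$ is the graph on the same vertices where distinct $s,t$ are adjacent iff $f_p(s)f_q(t)+f_q(s)f_p(t)+f_s(t)\equiv1\pmod 2$; the operation can only be applied to a pair of adjacent non-root vertices. Rank is over $\mathbb F_2$. -}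

module Defs where

open import Data.Nat using (ℕ; zero; suc; _≤_)
open import Data.Fin using (Fin; zero; suc; inject₁; fromℕ; _≟_)
open import Data.Fin.Subset using (Subset; _⊆_; ∣_∣; ⊥)
open import Data.Vec using (lookup)
open import Data.Bool using (Bool; true; false; _∧_; _xor_; if_then_else_)
open import Data.Product using (Σ; _×_; _,_)
open import Relation.Binary.PropositionalEquality using (_≡_; _≢_)
open import Relation.Nullary using (¬_; Dec; yes; no)

-- Adjacency function (= adjacency matrix over F₂, true ↦ 1, false ↦ 0)
-- on the vertex set Fin n.
Adj : ℕ → Set
Adj n = Fin n → Fin n → Bool

IsSimple : ∀ {n} → Adj n → Set
IsSimple {n} G = (∀ (s t : Fin n) → G s t ≡ G t s) × (∀ (s : Fin n) → G s s ≡ false)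

-- A two-rooted graph on v₁,…,vₙ with n = m + 2; vertex v₁ is 'zero',
-- vertex vₙ is 'fromℕ (suc m)'.  These are the roots.
root₁ : ∀ {m} → Fin (suc (suc m))
root₁ = zero

root₂ : ∀ {m} → Fin (suc (suc m))
root₂ {m} = fromℕ (suc m)

NonRoot : ∀ {m} → Fin (suc (suc m)) → Set
NonRoot v = (v ≢ root₁) × (v ≢ root₂)

gcds : ∀ {n} → Fin n → Fin n → Adj n → Adj n
gcds p q G s t with s ≟ t
... | yes _ = false
... | no  _ = ((G p s ∧ G q t) xor (G q s ∧ G p t)) xor G s t

Step : ∀ {m} → Adj (suc (suc m)) → Adj (suc (suc m)) → Set
Step {m} G H = Σ (Fin (suc (suc m))) λ p → Σ (Fin (suc (suc m))) λ q →
  NonRoot p × NonRoot q × G p q ≡ true × H ≡ gcds p q G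

data Steps {m : ℕ} : Adj (suc (suc m)) → ℕ → Adj (suc (suc m)) → Set where
  done : ∀ {G} → Steps G zero G
  step : ∀ {G H K k} → Step G H → Steps H k K → Steps G (suc k) K

FixedPoint : ∀ {m} → Adj (suc (suc m)) → Set
FixedPoint {m} G = ∀ (p q : Fin (suc (suc m))) → NonRoot p → NonRoot q → G p q ≡ false

cent : ∀ {m} → Adj (suc (suc m)) → Fin m → Fin m → Bool
cent M i j = M (suc (inject₁ i)) (suc (inject₁ j))

xorSum : ∀ {k} → (Fin k → Bool) → Bool
xorSum {zero}  f = false
xorSum {suc k} f = f zero xor xorSum (λ i → f (suc i))

rowSum : ∀ {r c} → (Fin r → Fin c → Bool) → Subset r → Fin c → Bool
rowSum A T j = xorSum (λ i → lookup T i ∧ A i j)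

RowsIndependent : ∀ {r c} → (Fin r → Fin c → Bool) → Subset r → Set
RowsIndependent {r} {c} A S =
  ∀ (T : Subset r) → T ⊆ S → (∀ (j : Fin c) → rowSum A T j ≡ false) → T ≡ ⊥

HasRank : ∀ {r c} → (Fin r → Fin c → Bool) → ℕ → Set
HasRank {r} A k =
  (Σ (Subset r) λ S → RowsIndependent A S × ∣ S ∣ ≡ k) ×
  (∀ (S : Subset r) → RowsIndependent A S → ∣ S ∣ ≤ k)

-- Over F₂, gcds on an edge pq between inner vertices acts on the central
-- matrix as two Gaussian eliminations: column p with pivot row q, then column
-- q with pivot row p.  Eliminating a column with a pivot row of the matrix
-- itself lowers the rank by exactly one: an independent set of rows stays
-- independent after dropping at most one row, and the pivot row, which becomes
-- zero, can be added back to any independent set of the eliminated matrix.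
-- So every step lowers the rank of the central matrix by two, and at a fixed
-- point the central matrix is zero.

module Submission where

open import Defs
open import Data.Nat using (ℕ; suc; _*_)
open import Relation.Binary.PropositionalEquality using (_≡_)

open import Algebra.Bundles using (CommutativeRing)
open import Data.Bool using (Bool; true; false; _∧_; _xor_)
open import Data.Bool.Properties as Bool
  using (xor-∧-commutativeRing; xor-assoc; xor-comm; xor-same; xor-identityʳ;
         ∧-comm; ∧-assoc; ∧-zeroʳ; ∧-identityʳ; ∧-distribˡ-xor; ∧-distribʳ-xor)
open import Data.Fin using (Fin; zero; suc; inject₁; fromℕ; toℕ; lower₁; punchIn; _≟_)
open import Data.Fin.Properties
  using (all?; suc-injective; punchInᵢ≢i; fromℕ≢inject₁; inject₁-lower₁; toℕ-injective; toℕ-fromℕ)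
open import Data.Fin.Subset
  using (Subset; inside; outside; _∈_; _∉_; _⊆_; _∪_; _-_; ⁅_⁆; ∣_∣; ⊥; Nonempty; Empty)
open import Data.Fin.Subset.Properties
  using (_⊆?_; anySubset?; nonempty?; Empty-unique; ∉⊥; ⊥⊆; ⊆-refl; ⊆-trans; ⊆-antisym;
         ∣⊥∣≡0; x∈⁅x⁆; x∈⁅y⁆⇒x≡y; x∈p∪q⁻; p─q⊆p; p─⊥≡p; x∈p∧x≢y⇒x∈p-y; ∪-identityʳ;
         drop-not-there)
open import Data.Nat using (zero; _+_; _≤_; s≤s)
open import Data.Nat.Properties using (≤-antisym; ≤-trans; ≤-refl; ≤-reflexive; n≤1+n; *-suc)
open import Data.Product using (∃-syntax; _×_; _,_)
open import Data.Sum using (_⊎_; inj₁; inj₂)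
open import Data.Vec using (_∷_; here; lookup; zipWith)
open import Data.Vec.Properties using ([]=⇒lookup; lookup⇒[]=; lookup-zipWith; lookup-replicate)
open import Function using (_∘_; const)
open import Relation.Binary.PropositionalEquality
  using (refl; sym; trans; cong; cong₂; subst; _≢_; _≗_; module ≡-Reasoning)
open import Relation.Nullary using (¬_; Dec; yes; no; contradiction)
open import Relation.Nullary.Decidable using (_×-dec_)

open CommutativeRing xor-∧-commutativeRing using (semiring)
open import Algebra.Properties.Semiring.Sum semiring using (sum; sum-cong-≗; ∑-distrib-+; *-distribʳ-sum; sum-remove)

private
  variable
    c m n r : ℕ

Matrix : ℕ → ℕ → Set
Matrix r c = Fin r → Fin c → Bool

xor-≡false⇒≡ : ∀ {x y} → x xor y ≡ false → x ≡ y
xor-≡false⇒≡ {true}  {true}  _ = refl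
xor-≡false⇒≡ {false} {false} _ = refl

xor-≡true⇒ : ∀ {x y} → x xor y ≡ true → x ≡ true ⊎ y ≡ true
xor-≡true⇒ {true}  _   = inj₁ refl
xor-≡true⇒ {false} y≡t = inj₂ y≡t

xorSum≡sum : (f : Fin n → Bool) → xorSum f ≡ sum f
xorSum≡sum {zero}  f = refl
xorSum≡sum {suc n} f = cong (f zero xor_) (xorSum≡sum (f ∘ suc))

xorSum-cong : {f g : Fin n → Bool} → f ≗ g → xorSum f ≡ xorSum g
xorSum-cong {f = f} {g} f≗g = begin
  xorSum f ≡⟨ xorSum≡sum f ⟩
  sum f    ≡⟨ sum-cong-≗ f≗g ⟩
  sum g    ≡⟨ xorSum≡sum g ⟨
  xorSum g ∎
  where open ≡-Reasoning

xorSum-xor : (f g : Fin n → Bool) → xorSum (λ i → f i xor g i) ≡ xorSum f xor xorSum g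
xorSum-xor f g = begin
  xorSum (λ i → f i xor g i) ≡⟨ xorSum≡sum (λ i → f i xor g i) ⟩
  sum (λ i → f i xor g i)    ≡⟨ ∑-distrib-+ f g ⟩
  sum f xor sum g            ≡⟨ cong₂ _xor_ (xorSum≡sum f) (xorSum≡sum g) ⟨
  xorSum f xor xorSum g      ∎
  where open ≡-Reasoning

xorSum-∧ʳ : (f : Fin n → Bool) (b : Bool) → xorSum (λ i → f i ∧ b) ≡ xorSum f ∧ b
xorSum-∧ʳ f b = begin
  xorSum (λ i → f i ∧ b) ≡⟨ xorSum≡sum (λ i → f i ∧ b) ⟩
  sum (λ i → f i ∧ b)    ≡⟨ *-distribʳ-sum b f ⟨
  sum f ∧ b              ≡⟨ cong (_∧ b) (xorSum≡sum f) ⟨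
  xorSum f ∧ b           ∎
  where open ≡-Reasoning

xorSum-remove : (f : Fin (suc n) → Bool) (i : Fin (suc n)) → xorSum f ≡ f i xor xorSum (f ∘ punchIn i)
xorSum-remove f i = begin
  xorSum f                        ≡⟨ xorSum≡sum f ⟩
  sum f                           ≡⟨ sum-remove f ⟩
  f i xor sum (f ∘ punchIn i)     ≡⟨ cong (f i xor_) (xorSum≡sum (f ∘ punchIn i)) ⟨
  f i xor xorSum (f ∘ punchIn i)  ∎
  where open ≡-Reasoning

xorSum-zero : {f : Fin n → Bool} → f ≗ const false → xorSum f ≡ false
xorSum-zero {zero}  f≗0 = refl
xorSum-zero {suc n} f≗0 = cong₂ _xor_ (f≗0 zero) (xorSum-zero (f≗0 ∘ suc))

_∆_ : Subset n → Subset n → Subset n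
p ∆ q = zipWith _xor_ p q

lookup-∉ : ∀ {x} {p : Subset n} → x ∉ p → lookup p x ≡ false
lookup-∉ {x = x} {p} x∉p with lookup p x in eq
... | false = refl
... | true  = contradiction (lookup⇒[]= x p eq) x∉p

lookup-minus-same : (p : Subset n) (i : Fin n) → lookup (p - i) i ≡ false
lookup-minus-same (s ∷ p) zero    = refl
lookup-minus-same (s ∷ p) (suc i) = lookup-minus-same p i

lookup-minus-other : (p : Subset n) {i x : Fin n} → x ≢ i → lookup (p - i) x ≡ lookup p x
lookup-minus-other (s ∷ p) {zero}  {zero}  x≢i = contradiction refl x≢i
lookup-minus-other (s ∷ p) {zero}  {suc x} x≢i = cong (λ q → lookup q x) (p─⊥≡p p)
lookup-minus-other (s ∷ p) {suc i} {zero}  x≢i = refl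
lookup-minus-other (s ∷ p) {suc i} {suc x} x≢i = lookup-minus-other p (x≢i ∘ cong suc)

i∉p-i : {p : Subset n} {i : Fin n} → i ∉ p - i
i∉p-i {p = p} {i} i∈p-i with () ← trans (sym ([]=⇒lookup i∈p-i)) (lookup-minus-same p i)

i∉p⇒p-i≡p : {p : Subset n} {i : Fin n} → i ∉ p → p - i ≡ p
i∉p⇒p-i≡p {p = p} {i} i∉p = ⊆-antisym (p─q⊆p p ⁅ i ⁆) (λ x∈p → x∈p∧x≢y⇒x∈p-y x∈p λ { refl → i∉p x∈p })

p⊆s∧q⊆s⇒p∆q⊆s : {p q s : Subset n} → p ⊆ s → q ⊆ s → p ∆ q ⊆ s
p⊆s∧q⊆s⇒p∆q⊆s {p = p} {q} p⊆s q⊆s {x} x∈p∆q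
  with xor-≡true⇒ (trans (sym (lookup-zipWith _xor_ x p q)) ([]=⇒lookup x∈p∆q))
... | inj₁ x∈p = p⊆s (lookup⇒[]= x p x∈p)
... | inj₂ x∈q = q⊆s (lookup⇒[]= x q x∈q)

x∉p∧x∈q⇒x∈p∆q : {p q : Subset n} {x : Fin n} → x ∉ p → x ∈ q → x ∈ p ∆ q
x∉p∧x∈q⇒x∈p∆q {p = p} {q} {x} x∉p x∈q = lookup⇒[]= x (p ∆ q) (begin
  lookup (p ∆ q) x              ≡⟨ lookup-zipWith _xor_ x p q ⟩
  lookup p x xor lookup q x     ≡⟨ cong₂ _xor_ (lookup-∉ x∉p) ([]=⇒lookup x∈q) ⟩
  true                          ∎)
  where open ≡-Reasoning

∣p∣≤1+∣p-i∣ : (p : Subset n) (i : Fin n) → ∣ p ∣ ≤ suc ∣ p - i ∣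
∣p∣≤1+∣p-i∣ (inside  ∷ p) zero    = ≤-reflexive (cong (suc ∘ ∣_∣) (sym (p─⊥≡p p)))
∣p∣≤1+∣p-i∣ (outside ∷ p) zero    = ≤-trans (n≤1+n _) (≤-reflexive (cong (suc ∘ ∣_∣) (sym (p─⊥≡p p))))
∣p∣≤1+∣p-i∣ (inside  ∷ p) (suc i) = s≤s (∣p∣≤1+∣p-i∣ p i)
∣p∣≤1+∣p-i∣ (outside ∷ p) (suc i) = ∣p∣≤1+∣p-i∣ p i

∣p∪⁅i⁆∣≡1+∣p∣ : (p : Subset n) {i : Fin n} → i ∉ p → ∣ p ∪ ⁅ i ⁆ ∣ ≡ suc ∣ p ∣
∣p∪⁅i⁆∣≡1+∣p∣ (inside  ∷ p) {zero}  i∉p = contradiction here i∉p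
∣p∪⁅i⁆∣≡1+∣p∣ (outside ∷ p) {zero}  i∉p = cong (suc ∘ ∣_∣) (∪-identityʳ p)
∣p∪⁅i⁆∣≡1+∣p∣ (inside  ∷ p) {suc i} i∉p = cong suc (∣p∪⁅i⁆∣≡1+∣p∣ p (drop-not-there i∉p))
∣p∪⁅i⁆∣≡1+∣p∣ (outside ∷ p) {suc i} i∉p = ∣p∪⁅i⁆∣≡1+∣p∣ p (drop-not-there i∉p)

rowSum-cong : (A B : Matrix r c) {t : Fin c} → (∀ i → A i t ≡ B i t) →
  (T : Subset r) → rowSum A T t ≡ rowSum B T t
rowSum-cong A B A≡B T = xorSum-cong (λ i → cong (lookup T i ∧_) (A≡B i))

rowSum-zeroColumn : (A : Matrix r c) {t : Fin c} → (∀ i → A i t ≡ false) →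
  (T : Subset r) → rowSum A T t ≡ false
rowSum-zeroColumn A A≡0 T = xorSum-zero (λ i → trans (cong (lookup T i ∧_) (A≡0 i)) (∧-zeroʳ (lookup T i)))

rowSum-⊥ : (A : Matrix r c) (t : Fin c) → rowSum A ⊥ t ≡ false
rowSum-⊥ A t = xorSum-zero (λ i → cong (_∧ A i t) (lookup-replicate i outside))

rowSum-⁅⁆ : (A : Matrix r c) (i : Fin r) (t : Fin c) → rowSum A ⁅ i ⁆ t ≡ A i t
rowSum-⁅⁆ A zero    t = trans (cong (A zero t xor_) (rowSum-⊥ (A ∘ suc) t)) (xor-identityʳ (A zero t))
rowSum-⁅⁆ A (suc i) t = rowSum-⁅⁆ (A ∘ suc) i t

rowSum-∆ : (A : Matrix r c) (T U : Subset r) (t : Fin c) → rowSum A (T ∆ U) t ≡ rowSum A T t xor rowSum A U t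
rowSum-∆ A T U t = trans (xorSum-cong distrib) (xorSum-xor (λ i → lookup T i ∧ A i t) (λ i → lookup U i ∧ A i t))
  where
  distrib : ∀ i → lookup (T ∆ U) i ∧ A i t ≡ (lookup T i ∧ A i t) xor (lookup U i ∧ A i t)
  distrib i = trans (cong (_∧ A i t) (lookup-zipWith _xor_ i T U)) (∧-distribʳ-xor (A i t) (lookup T i) (lookup U i))

rowSum-minus : (A : Matrix (suc r) c) (T : Subset (suc r)) (i : Fin (suc r)) (t : Fin c) →
  rowSum A T t ≡ (lookup T i ∧ A i t) xor rowSum A (T - i) t
rowSum-minus {r = r} A T i t = begin
  rowSum A T t                                       ≡⟨ xorSum-remove f i ⟩
  (lookup T i ∧ A i t) xor xorSum (f ∘ punchIn i)    ≡⟨ cong (f i xor_) (xorSum-cong outside-i) ⟩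
  (lookup T i ∧ A i t) xor xorSum (g ∘ punchIn i)    ≡⟨ cong (f i xor_) g-sum ⟨
  (lookup T i ∧ A i t) xor rowSum A (T - i) t        ∎
  where
  open ≡-Reasoning
  f g : Fin (suc r) → Bool
  f x = lookup T x ∧ A x t
  g x = lookup (T - i) x ∧ A x t
  outside-i : f ∘ punchIn i ≗ g ∘ punchIn i
  outside-i x = cong (_∧ A (punchIn i x) t) (sym (lookup-minus-other T (punchInᵢ≢i i x)))
  g-sum : xorSum g ≡ xorSum (g ∘ punchIn i)
  g-sum = trans (xorSum-remove g i) (cong (λ b → (b ∧ A i t) xor xorSum (g ∘ punchIn i)) (lookup-minus-same T i))

rowSum-zeroRow : (A : Matrix (suc r) c) (T : Subset (suc r)) {i : Fin (suc r)} → A i ≗ const false →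
  rowSum A T ≗ rowSum A (T - i)
rowSum-zeroRow A T {i} Ai≡0 t = begin
  rowSum A T t                                 ≡⟨ rowSum-minus A T i t ⟩
  (lookup T i ∧ A i t) xor rowSum A (T - i) t  ≡⟨ cong (λ b → (lookup T i ∧ b) xor rowSum A (T - i) t) (Ai≡0 t) ⟩
  (lookup T i ∧ false) xor rowSum A (T - i) t  ≡⟨ cong (_xor rowSum A (T - i) t) (∧-zeroʳ (lookup T i)) ⟩
  rowSum A (T - i) t                           ∎
  where open ≡-Reasoning

rowSum-T-i≡⊥ : (A : Matrix (suc r) c) (T : Subset (suc r)) {i : Fin (suc r)} → T - i ≡ ⊥ →
  ∀ t → rowSum A T t ≡ lookup T i ∧ A i t
rowSum-T-i≡⊥ A T {i} T-i≡⊥ t = begin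
  rowSum A T t                                 ≡⟨ rowSum-minus A T i t ⟩
  (lookup T i ∧ A i t) xor rowSum A (T - i) t  ≡⟨ cong (λ U → (lookup T i ∧ A i t) xor rowSum A U t) T-i≡⊥ ⟩
  (lookup T i ∧ A i t) xor rowSum A ⊥ t        ≡⟨ cong ((lookup T i ∧ A i t) xor_) (rowSum-⊥ A t) ⟩
  (lookup T i ∧ A i t) xor false               ≡⟨ xor-identityʳ (lookup T i ∧ A i t) ⟩
  lookup T i ∧ A i t                           ∎
  where open ≡-Reasoning

-- For w j ≡ true: the Gaussian elimination step clearing entry j of u with pivot row w.
eliminate : Fin c → (Fin c → Bool) → (Fin c → Bool) → Fin c → Bool
eliminate j w u t = u t xor (u j ∧ w t)

eliminate-pivot : {j : Fin c} (w : Fin c → Bool) → w j ≡ true → eliminate j w w ≗ const false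
eliminate-pivot w wj≡true t = trans (cong (λ b → w t xor (b ∧ w t)) wj≡true) (xor-same (w t))

eliminate-inert : (j : Fin c) (w u : Fin c → Bool) → u j ≡ false → eliminate j w u ≗ u
eliminate-inert j w u uj≡false t = trans (cong (λ b → u t xor (b ∧ _)) uj≡false) (xor-identityʳ (u t))

eliminate-kernel : {j : Fin c} {w u : Fin c → Bool} → eliminate j w u ≗ const false → u ≗ const false ⊎ u ≗ w
eliminate-kernel {j = j} {u = u} elim≡0 with u j
... | false = inj₁ (λ t → xor-≡false⇒≡ (elim≡0 t))
... | true  = inj₂ (λ t → xor-≡false⇒≡ (elim≡0 t))

rowSum-eliminate : (A : Matrix r c) (j : Fin c) (w : Fin c → Bool) (T : Subset r) →
  rowSum (eliminate j w ∘ A) T ≗ eliminate j w (rowSum A T)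
rowSum-eliminate {r = r} A j w T t = begin
  xorSum (λ i → lookup T i ∧ eliminate j w (A i) t)  ≡⟨ xorSum-cong distrib ⟩
  xorSum (λ i → a i xor (b i ∧ w t))                 ≡⟨ xorSum-xor a (λ i → b i ∧ w t) ⟩
  xorSum a xor xorSum (λ i → b i ∧ w t)              ≡⟨ cong (xorSum a xor_) (xorSum-∧ʳ b (w t)) ⟩
  xorSum a xor (xorSum b ∧ w t)                      ∎
  where
  open ≡-Reasoning
  a b : Fin r → Bool
  a i = lookup T i ∧ A i t
  b i = lookup T i ∧ A i j
  distrib : ∀ i → lookup T i ∧ eliminate j w (A i) t ≡ a i xor (b i ∧ w t)
  distrib i = trans (∧-distribˡ-xor (lookup T i) (A i t) (A i j ∧ w t))
                    (cong (a i xor_) (sym (∧-assoc (lookup T i) (A i j) (w t))))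

RowsIndependent-cong : {A B : Matrix r c} → (∀ i t → A i t ≡ B i t) → {S : Subset r} →
  RowsIndependent A S → RowsIndependent B S
RowsIndependent-cong {A = A} {B} A≡B indS T T⊆S sum≡0 =
  indS T T⊆S (λ t → trans (rowSum-cong A B (λ i → A≡B i t) T) (sum≡0 t))

InRowSpan : Matrix r c → Subset r → (Fin c → Bool) → Set
InRowSpan A S w = ∃[ T ] T ⊆ S × rowSum A T ≗ w

inRowSpan? : (A : Matrix r c) (S : Subset r) (w : Fin c → Bool) → Dec (InRowSpan A S w)
inRowSpan? A S w = anySubset? (λ T → T ⊆? S ×-dec all? (λ t → rowSum A T t Bool.≟ w t))

independent-eliminate-∉rowSpan : {A : Matrix r c} {j : Fin c} {w : Fin c → Bool} {S : Subset r} →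
  RowsIndependent A S → ¬ InRowSpan A S w → RowsIndependent (eliminate j w ∘ A) S
independent-eliminate-∉rowSpan {A = A} {j} {w} indS w∉span T T⊆S sum≡0
  with eliminate-kernel (λ t → trans (sym (rowSum-eliminate A j w T t)) (sum≡0 t))
... | inj₁ sumA≡0 = indS T T⊆S sumA≡0
... | inj₂ sumA≡w = contradiction (T , (λ {x} → T⊆S {x}) , sumA≡w) w∉span

independent-eliminate-minus : {A : Matrix r c} {j : Fin c} {w : Fin c → Bool} {S T₀ : Subset r} {i : Fin r} →
  RowsIndependent A S → T₀ ⊆ S → rowSum A T₀ ≗ w → i ∈ T₀ → RowsIndependent (eliminate j w ∘ A) (S - i)
independent-eliminate-minus {A = A} {j} {w} {S} {T₀} {i} indS T₀⊆S sumT₀≡w i∈T₀ T T⊆S-i sum≡0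
  with eliminate-kernel (λ t → trans (sym (rowSum-eliminate A j w T t)) (sum≡0 t))
... | inj₁ sumA≡0 = indS T (⊆-trans T⊆S-i (p─q⊆p S ⁅ i ⁆)) sumA≡0
... | inj₂ sumA≡w = contradiction (subst (i ∈_) T∆T₀≡⊥ (x∉p∧x∈q⇒x∈p∆q (i∉p-i ∘ T⊆S-i) i∈T₀)) ∉⊥
  where
  T∆T₀≡⊥ : T ∆ T₀ ≡ ⊥
  T∆T₀≡⊥ = indS (T ∆ T₀) (p⊆s∧q⊆s⇒p∆q⊆s (⊆-trans T⊆S-i (p─q⊆p S ⁅ i ⁆)) T₀⊆S) λ t → begin
    rowSum A (T ∆ T₀) t            ≡⟨ rowSum-∆ A T T₀ t ⟩
    rowSum A T t xor rowSum A T₀ t ≡⟨ cong₂ _xor_ (sumA≡w t) (sumT₀≡w t) ⟩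
    w t xor w t                    ≡⟨ xor-same (w t) ⟩
    false                          ∎
    where open ≡-Reasoning

rowSum-nonzero⇒Nonempty : {A : Matrix r c} {T : Subset r} {t : Fin c} → rowSum A T t ≡ true → Nonempty T
rowSum-nonzero⇒Nonempty {A = A} {T} {t} sum≡true with nonempty? T
... | yes T-nonempty = T-nonempty
... | no T-empty with () ←
  trans (sym sum≡true) (trans (cong (λ U → rowSum A U t) (Empty-unique T-empty)) (rowSum-⊥ A t))

independent-eliminate : {A : Matrix r c} {j : Fin c} {w : Fin c → Bool} {S : Subset r} → w j ≡ true →
  RowsIndependent A S → ∃[ S′ ] RowsIndependent (eliminate j w ∘ A) S′ × ∣ S ∣ ≤ suc ∣ S′ ∣
independent-eliminate {A = A} {j} {w} {S} wj≡true indS with inRowSpan? A S w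
... | no w∉span = S , independent-eliminate-∉rowSpan indS w∉span , n≤1+n ∣ S ∣
... | yes (T₀ , T₀⊆S , sumT₀≡w) with rowSum-nonzero⇒Nonempty {A = A} {t = j} (trans (sumT₀≡w j) wj≡true)
...   | i , i∈T₀ = S - i , independent-eliminate-minus indS T₀⊆S sumT₀≡w i∈T₀ , ∣p∣≤1+∣p-i∣ S i

zeroRow-∉ : {A : Matrix r c} {i : Fin r} {S : Subset r} → A i ≗ const false → RowsIndependent A S → i ∉ S
zeroRow-∉ {A = A} {i} {S} Ai≡0 indS i∈S = ∉⊥ (subst (i ∈_) ⁅i⁆≡⊥ (x∈⁅x⁆ i))
  where
  ⁅i⁆⊆S : ⁅ i ⁆ ⊆ S
  ⁅i⁆⊆S x∈⁅i⁆ = subst (_∈ S) (sym (x∈⁅y⁆⇒x≡y i x∈⁅i⁆)) i∈S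
  ⁅i⁆≡⊥ : ⁅ i ⁆ ≡ ⊥
  ⁅i⁆≡⊥ = indS ⁅ i ⁆ ⁅i⁆⊆S (λ t → trans (rowSum-⁅⁆ A i t) (Ai≡0 t))

independent-pivot : {A : Matrix r c} {i : Fin r} {j : Fin c} {S : Subset r} → A i j ≡ true →
  RowsIndependent (eliminate j (A i) ∘ A) S → RowsIndependent A (S ∪ ⁅ i ⁆)
independent-pivot {r = suc r} {c = c} {A = A} {i} {j} {S} Aij≡true indS T T⊆S∪i sum≡0 =
  trans (sym (i∉p⇒p-i≡p i∉T)) T-i≡⊥
  where
  B : Matrix (suc r) c
  B = eliminate j (A i) ∘ A
  T-i⊆S : T - i ⊆ S
  T-i⊆S {x} x∈T-i with x∈p∪q⁻ S ⁅ i ⁆ (T⊆S∪i (p─q⊆p T ⁅ i ⁆ x∈T-i))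
  ... | inj₁ x∈S   = x∈S
  ... | inj₂ x∈⁅i⁆ = contradiction (subst (_∈ T - i) (x∈⁅y⁆⇒x≡y i x∈⁅i⁆) x∈T-i) i∉p-i
  T-i≡⊥ : T - i ≡ ⊥
  T-i≡⊥ = indS (T - i) T-i⊆S λ t → begin
    rowSum B (T - i) t                 ≡⟨ rowSum-zeroRow B T (eliminate-pivot (A i) Aij≡true) t ⟨
    rowSum B T t                       ≡⟨ rowSum-eliminate A j (A i) T t ⟩
    eliminate j (A i) (rowSum A T) t   ≡⟨ cong₂ (λ x y → x xor (y ∧ A i t)) (sum≡0 t) (sum≡0 j) ⟩
    false                              ∎
    where open ≡-Reasoning
  Ti≡false : lookup T i ≡ false
  Ti≡false = begin
    lookup T i          ≡⟨ ∧-identityʳ (lookup T i) ⟨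
    lookup T i ∧ true   ≡⟨ cong (lookup T i ∧_) Aij≡true ⟨
    lookup T i ∧ A i j  ≡⟨ rowSum-T-i≡⊥ A T T-i≡⊥ j ⟨
    rowSum A T j        ≡⟨ sum≡0 j ⟩
    false               ∎
    where open ≡-Reasoning
  i∉T : i ∉ T
  i∉T i∈T = contradiction (trans (sym ([]=⇒lookup i∈T)) Ti≡false) λ ()

HasRank-cong : {A B : Matrix r c} → (∀ i t → A i t ≡ B i t) → {k : ℕ} → HasRank A k → HasRank B k
HasRank-cong A≡B ((S , indS , ∣S∣≡k) , maximal) =
  (S , RowsIndependent-cong A≡B indS , ∣S∣≡k) ,
  λ S′ indS′ → maximal S′ (RowsIndependent-cong (λ i t → sym (A≡B i t)) indS′)

HasRank-unique : {A : Matrix r c} {k l : ℕ} → HasRank A k → HasRank A l → k ≡ l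
HasRank-unique ((S , indS , ∣S∣≡k) , maximalₖ) ((S′ , indS′ , ∣S′∣≡l) , maximalₗ) =
  ≤-antisym (subst (_≤ _) ∣S∣≡k (maximalₗ S indS)) (subst (_≤ _) ∣S′∣≡l (maximalₖ S′ indS′))

HasRank-zero : {A : Matrix r c} → (∀ i t → A i t ≡ false) → HasRank A 0
HasRank-zero {r} {A = A} A≡0 =
  (⊥ , (λ T T⊆⊥ _ → ⊆-antisym T⊆⊥ ⊥⊆) , ∣⊥∣≡0 r) ,
  λ S indS → ≤-reflexive (trans (cong ∣_∣ (indS S ⊆-refl (λ t → rowSum-zeroColumn A (λ i → A≡0 i t) S)))
                                (∣⊥∣≡0 r))

HasRank-pivot : {A : Matrix r c} {i : Fin r} {j : Fin c} {k : ℕ} → A i j ≡ true →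
  HasRank (eliminate j (A i) ∘ A) k → HasRank A (suc k)
HasRank-pivot {A = A} {i} Aij≡true ((S , indS , ∣S∣≡k) , maximal) =
  (S ∪ ⁅ i ⁆ , independent-pivot Aij≡true indS ,
   trans (∣p∪⁅i⁆∣≡1+∣p∣ S (zeroRow-∉ (eliminate-pivot (A i) Aij≡true) indS)) (cong suc ∣S∣≡k)) ,
  λ S′ indS′ → let (S″ , indS″ , ∣S′∣≤1+∣S″∣) = independent-eliminate Aij≡true indS′
               in ≤-trans ∣S′∣≤1+∣S″∣ (s≤s (maximal S″ indS″))

inner : Fin m → Fin (suc (suc m))
inner i = suc (inject₁ i)

inner-nonRoot : (i : Fin m) → NonRoot (inner i)
inner-nonRoot i = (λ ()) , (λ eq → fromℕ≢inject₁ (sym (suc-injective eq)))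

nonRoot⇒inner : {v : Fin (suc (suc m))} → NonRoot v → ∃[ i ] v ≡ inner i
nonRoot⇒inner {v = zero}      (v≢root₁ , _) = contradiction refl v≢root₁
nonRoot⇒inner {m} {v = suc v} (_ , v≢root₂) = lower₁ v m≢v , cong suc (sym (inject₁-lower₁ v m≢v))
  where
  m≢v : m ≢ toℕ v
  m≢v m≡v = v≢root₂ (cong suc (toℕ-injective (trans (sym m≡v) (sym (toℕ-fromℕ m)))))

gcds-unfold : (p q : Fin n) (G : Adj n) → (∀ s → G s s ≡ false) → (s t : Fin n) →
  gcds p q G s t ≡ ((G p s ∧ G q t) xor (G q s ∧ G p t)) xor G s t
gcds-unfold p q G irr s t with s ≟ t
... | no _     = refl
... | yes refl = begin
  false                                               ≡⟨ xor-same (G p s ∧ G q s) ⟨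
  (G p s ∧ G q s) xor (G p s ∧ G q s)                 ≡⟨ cong ((G p s ∧ G q s) xor_) (∧-comm (G p s) (G q s)) ⟩
  (G p s ∧ G q s) xor (G q s ∧ G p s)                 ≡⟨ xor-identityʳ _ ⟨
  ((G p s ∧ G q s) xor (G q s ∧ G p s)) xor false     ≡⟨ cong (((G p s ∧ G q s) xor (G q s ∧ G p s)) xor_) (irr s) ⟨
  ((G p s ∧ G q s) xor (G q s ∧ G p s)) xor G s s     ∎
  where open ≡-Reasoning

gcds-isSimple : (p q : Fin n) {G : Adj n} → IsSimple G → IsSimple (gcds p q G)
gcds-isSimple p q {G} (sym-G , irr) = symmetric , irreflexive
  where
  symmetric : ∀ s t → gcds p q G s t ≡ gcds p q G t s
  symmetric s t = begin
    gcds p q G s t                                        ≡⟨ gcds-unfold p q G irr s t ⟩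
    ((G p s ∧ G q t) xor (G q s ∧ G p t)) xor G s t       ≡⟨ cong₂ _xor_ swap (sym-G s t) ⟩
    ((G p t ∧ G q s) xor (G q t ∧ G p s)) xor G t s       ≡⟨ gcds-unfold p q G irr t s ⟨
    gcds p q G t s                                        ∎
    where
    open ≡-Reasoning
    swap : (G p s ∧ G q t) xor (G q s ∧ G p t) ≡ (G p t ∧ G q s) xor (G q t ∧ G p s)
    swap = trans (xor-comm (G p s ∧ G q t) (G q s ∧ G p t))
                 (cong₂ _xor_ (∧-comm (G q s) (G p t)) (∧-comm (G p s) (G q t)))
  irreflexive : ∀ s → gcds p q G s s ≡ false
  irreflexive s with s ≟ s
  ... | yes _  = refl
  ... | no s≢s = contradiction refl s≢s

Step-isSimple : {G H : Adj (suc (suc m))} → IsSimple G → Step G H → IsSimple H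
Step-isSimple simple (p , q , _ , _ , _ , refl) = gcds-isSimple p q simple

edgePivot : Matrix n n → Fin n → Fin n → Matrix n n
edgePivot {n = n} C a b = eliminate b (A a) ∘ A
  where
  A : Matrix n n
  A = eliminate a (C b) ∘ C

cent-gcds : {G : Adj (suc (suc m))} → IsSimple G → (a b : Fin m) →
  ∀ s t → cent (gcds (inner a) (inner b) G) s t ≡ edgePivot (cent G) a b s t
cent-gcds {m = m} {G = G} (sym-G , irr) a b s t = begin
  cent (gcds (inner a) (inner b) G) s t             ≡⟨ gcds-unfold (inner a) (inner b) G irr (inner s) (inner t) ⟩
  ((C a s ∧ C b t) xor (C b s ∧ C a t)) xor C s t   ≡⟨ xor-comm _ (C s t) ⟩
  C s t xor ((C a s ∧ C b t) xor (C b s ∧ C a t))   ≡⟨ xor-assoc (C s t) _ _ ⟨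
  (C s t xor (C a s ∧ C b t)) xor (C b s ∧ C a t)   ≡⟨ cong₂ (λ x y → (C s t xor (x ∧ C b t)) xor (y ∧ C a t))
                                                             (sym-G _ _) (sym-G _ _) ⟩
  A s t xor (C s b ∧ C a t)                         ≡⟨ cong₂ (λ x y → A s t xor (x ∧ y)) A-column-b A-row-a ⟨
  A s t xor (A s b ∧ A a t)                         ∎
  where
  open ≡-Reasoning
  C A : Matrix m m
  C = cent G
  A = eliminate a (C b) ∘ C
  A-column-b : A s b ≡ C s b
  A-column-b = begin
    C s b xor (C s a ∧ C b b) ≡⟨ cong (λ x → C s b xor (C s a ∧ x)) (irr (inner b)) ⟩
    C s b xor (C s a ∧ false) ≡⟨ cong (C s b xor_) (∧-zeroʳ (C s a)) ⟩
    C s b xor false           ≡⟨ xor-identityʳ (C s b) ⟩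
    C s b                     ∎
  A-row-a : A a t ≡ C a t
  A-row-a = eliminate-inert a (C b) (C a) (irr (inner a)) t

HasRank-step : {G H : Adj (suc (suc m))} → IsSimple G → Step G H →
  {k : ℕ} → HasRank (cent H) k → HasRank (cent G) (2 + k)
HasRank-step {G = G} simple@(sym-G , irr) (p , q , p-nonRoot , q-nonRoot , Gpq≡true , refl) rank
  with nonRoot⇒inner p-nonRoot | nonRoot⇒inner q-nonRoot
... | a , refl | b , refl =
  HasRank-pivot (trans (sym-G (inner b) (inner a)) Gpq≡true)
    (HasRank-pivot (trans (eliminate-inert a (cent G b) (cent G a) (irr (inner a)) b) Gpq≡true)
      (HasRank-cong (cent-gcds simple a b) rank))

HasRank-steps : {G H : Adj (suc (suc m))} {k : ℕ} → IsSimple G → Steps G k H → FixedPoint H →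
  HasRank (cent G) (2 * k)
HasRank-steps simple done fixed =
  HasRank-zero (λ i t → fixed (inner i) (inner t) (inner-nonRoot i) (inner-nonRoot t))
HasRank-steps {G = G} {k = suc k} simple (step st rest) fixed =
  subst (HasRank (cent G)) (sym (*-suc 2 k))
    (HasRank-step simple st (HasRank-steps (Step-isSimple simple st) rest fixed))

mainTheorem17 : ∀ (m : ℕ) (G : Adj (suc (suc m))) → IsSimple G →
    ∀ (r : ℕ) → HasRank (cent G) r →
    ∀ (k : ℕ) (H : Adj (suc (suc m))) → Steps G k H → FixedPoint H →
    2 * k ≡ r
mainTheorem17 m G simple r rank k H steps fixed = HasRank-unique (HasRank-steps simple steps fixed) rank
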